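{- For all labels $x$ and $y$, and nested sequents $X$ and $Y$, if $X$ and $Y$ are display equivalent, then $\mathfrak{L}_{x}(X)\cong \mathfrak{L}_{y}(Y)$.
   Context: Tense formulae: $A ::= p \mid \overline{p} \mid A\wedge A \mid A\vee A \mid \Box A \mid \Diamond A \mid \blacksquare A \mid \Diamond^{ - }A$, with $\Diamond^{ - }$ the past diamond. Nested sequents: $X ::= \varepsilon \mid A \mid X,X \mid \circ\{X\} \mid \bullet\{X\}$. The display rules are $(\textsf{rf})$: from $X,\circ\{Y\}$ infer $\bullet\{X\},Y$, and $(\textsf{rp})$: from $X,\bullet\{Y\}$ infer $\circ\{X\},Y$; two nested sequents are display equivalent if they are mutually derivable using only these rules. A labeled graph $(V,E,L)$ is a directed graph with vertices labeled by multisets of formulae; $\cong$ is labeled graph isomorphism (vertex bijection preserving edges and labels). The map $\mathfrak{L}_x$: $\mathfrak{L}_{x}(\varepsilon) = (\emptyset, \emptyset, \emptyset)$; $\mathfrak{L}_{x}(A) = (\{x\},\emptyset,\{(x,A)\})$; $\mathfrak{L}_{x}(X_1,X_2)$ is the union of $\mathfrak{L}_{x}(X_1)$ and $\mathfrak{L}_{x}(X_2)$ (multiset union of labels on shared vertices); $\mathfrak{L}_{x}(\circ\{X\})$ adds vertex $x$ and edge $(x,y)$ to $\mathfrak{L}_{y}(X)$, and $\mathfrak{L}_{x}(\bullet\{X\})$ adds vertex $x$ and edge $(y,x)$ to $\mathfrak{L}_{y}(X)$, with $y$ fresh. -}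

module Defs where

open import Data.Nat using (ℕ; zero; suc)
open import Data.Nat.Properties using () renaming (_≟_ to _≟ℕ_)
open import Data.List using (List; []; _∷_; _++_; map; filter)
open import Data.List.Properties using (≡-dec)
open import Data.List.Membership.Propositional using (_∈_)
open import Data.List.Relation.Binary.Permutation.Propositional using (_↭_)
open import Data.Product using (Σ; ∃; ∃-syntax; _×_; _,_; proj₁; proj₂)
open import Data.Sum using (_⊎_)
open import Relation.Binary.PropositionalEquality using (_≡_)
open import Relation.Binary.Definitions using (DecidableEquality)
open import Relation.Nullary using (Dec)
open import Function using (_∘_)

-- Tense formulae (negation normal form); propositional variables are ℕ.

data Formula : Set where
  var   : ℕ → Formula
  nvar  : ℕ → Formula
  _∧_   : Formula → Formula → Formula
  _∨_   : Formula → Formula → Formula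
  □_    : Formula → Formula
  ◇_    : Formula → Formula
  ■_    : Formula → Formula       -- past box
  ◇⁻_   : Formula → Formula       -- past diamond

data Seq : Set where
  ε    : Seq
  fm   : Formula → Seq
  _,,_ : Seq → Seq → Seq
  ∘[_] : Seq → Seq
  •[_] : Seq → Seq

infixr 4 _,,_

data _≈ₛ_ : Seq → Seq → Set where
  ≈-refl  : ∀ {X} → X ≈ₛ X
  ≈-sym   : ∀ {X Y} → X ≈ₛ Y → Y ≈ₛ X
  ≈-trans : ∀ {X Y Z} → X ≈ₛ Y → Y ≈ₛ Z → X ≈ₛ Z
  ≈-assoc : ∀ {X Y Z} → ((X ,, Y) ,, Z) ≈ₛ (X ,, (Y ,, Z))
  ≈-comm  : ∀ {X Y} → (X ,, Y) ≈ₛ (Y ,, X)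
  ≈-unit  : ∀ {X} → (ε ,, X) ≈ₛ X
  ≈-,,    : ∀ {X X′ Y Y′} → X ≈ₛ X′ → Y ≈ₛ Y′ → (X ,, Y) ≈ₛ (X′ ,, Y′)
  ≈-∘     : ∀ {X X′} → X ≈ₛ X′ → ∘[ X ] ≈ₛ ∘[ X′ ]
  ≈-•     : ∀ {X X′} → X ≈ₛ X′ → •[ X ] ≈ₛ •[ X′ ]

data DisplayStep : Seq → Seq → Set where
  rf : ∀ {S T} X Y → S ≈ₛ (X ,, ∘[ Y ]) → T ≈ₛ (•[ X ] ,, Y) → DisplayStep S T
  rp : ∀ {S T} X Y → S ≈ₛ (X ,, •[ Y ]) → T ≈ₛ (∘[ X ] ,, Y) → DisplayStep S T

data DisplayDerives : Seq → Seq → Set where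
  done : ∀ {X Y} → X ≈ₛ Y → DisplayDerives X Y
  step : ∀ {X Y Z} → DisplayStep X Y → DisplayDerives Y Z → DisplayDerives X Z

DisplayEquiv : Seq → Seq → Set
DisplayEquiv X Y = DisplayDerives X Y × DisplayDerives Y X

Label : Set
Label = List ℕ

_≟L_ : DecidableEquality Label
_≟L_ = ≡-dec _≟ℕ_

-- A labeled graph (V, E, L); L is a finite multiset of (vertex, formula)
-- pairs, so the label of a vertex is a multiset of formulae.
record LGraph : Set where
  constructor lgraph
  field
    V : List Label
    E : List (Label × Label)
    L : List (Label × Formula)
open LGraph public

emptyG : LGraph
emptyG = lgraph [] [] []

_∪G_ : LGraph → LGraph → LGraph
lgraph V₁ E₁ L₁ ∪G lgraph V₂ E₂ L₂ = lgraph (V₁ ++ V₂) (E₁ ++ E₂) (L₁ ++ L₂)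

labelOf : LGraph → Label → List Formula
labelOf G v = map proj₂ (filter (λ p → proj₁ p ≟L v) (L G))

record _≅_ (G H : LGraph) : Set where
  field
    to      : Label → Label
    from    : Label → Label
    to∈     : ∀ {v} → v ∈ V G → to v ∈ V H
    from∈   : ∀ {w} → w ∈ V H → from w ∈ V G
    from∘to : ∀ {v} → v ∈ V G → from (to v) ≡ v
    to∘from : ∀ {w} → w ∈ V H → to (from w) ≡ w
    edge→   : ∀ {u v} → u ∈ V G → v ∈ V G → (u , v) ∈ E G → (to u , to v) ∈ E H
    edge←   : ∀ {u v} → u ∈ V G → v ∈ V G → (to u , to v) ∈ E H → (u , v) ∈ E G
    label   : ∀ {v} → v ∈ V G → labelOf G v ↭ labelOf H (to v)

-- Fresh labels: the n-th bracket directly below a vertex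
-- labelled x receives the label n ∷ x (n counted left to right), which is
-- distinct from x and from every other label occurring in the construction.

build : Label → ℕ → Seq → LGraph × ℕ
build x n ε = emptyG , n
build x n (fm A) = lgraph (x ∷ []) [] ((x , A) ∷ []) , n
build x n (X₁ ,, X₂) with build x n X₁
... | G₁ , n₁ with build x n₁ X₂
... | G₂ , n₂ = G₁ ∪G G₂ , n₂
build x n ∘[ X ] with build (n ∷ x) 0 X
... | G , _ = lgraph (x ∷ (n ∷ x) ∷ V G) ((x , n ∷ x) ∷ E G) (L G) , suc n
build x n •[ X ] with build (n ∷ x) 0 X
... | G , _ = lgraph (x ∷ (n ∷ x) ∷ V G) ((n ∷ x , x) ∷ E G) (L G) , suc n

𝔏 : Label → Seq → LGraph
𝔏 x X = proj₁ (build x 0 X)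

-- Gluing lemma: if G₁ ≅ H₁ and G₂ ≅ H₂ agree on the single vertex where G₁
-- meets G₂ (resp. H₁ meets H₂), they combine to G₁ ∪ G₂ ≅ H₁ ∪ H₂.  The fresh
-- labels chosen by 𝔏 put each piece of 𝔏 x X into its own region of labels (its
-- root plus the descendants of a range of bracket indices), so the pieces meet
-- only at their shared root.  By induction, 𝔏 therefore respects the multiset
-- reading of the comma and depends neither on the root label nor on the bracket
-- numbering.  For (rf), both 𝔏 x (X , ∘{Y}) and 𝔏 y (•{X} , Y) consist of a copy
-- of X and a copy of Y joined by one edge from the root of X to the root of Y;
-- gluing X ≅ X, edge ≅ edge and Y ≅ Y gives the isomorphism, and (rp) is the
-- same with the edge reversed.  A derivation is a chain of such steps, so one
-- direction of the display equivalence already suffices.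

module Submission where

open import Defs
open import Data.Nat using (ℕ; suc; _≤_; _<_)
open import Data.Nat.Properties using (≤-refl; ≤-trans; <-≤-trans; <-irrefl; n≤1+n)
open import Data.List using (List; []; _∷_; _++_; _∷ʳ_; map; filter)
open import Data.List.Properties using (filter-++; filter-none; map-++; ++-cancelʳ; ∷ʳ-injectiveʳ; ∷ʳ-++; ++-identityˡ-unique)
open import Data.List.Relation.Unary.All using (tabulate)
open import Data.List.Relation.Unary.Any using (here; there)
open import Data.List.Membership.Propositional using (_∈_; _∉_)
open import Data.List.Membership.Propositional.Properties using (∈-++⁺ˡ; ∈-++⁺ʳ; ∈-++⁻)
open import Data.List.Membership.DecPropositional _≟L_ using (_∈?_)
open import Data.List.Relation.Binary.Permutation.Propositional using (_↭_; ↭-refl; ↭-sym; ↭-trans; ↭-reflexive)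
open import Data.List.Relation.Binary.Permutation.Propositional.Properties using (∈-resp-↭; map⁺; filter-↭; ++⁺; ++⁺ʳ; ++-comm) renaming (++-assoc to ++-assoc-↭)
open import Data.Product using (Σ; ∃₂; _×_; _,_; proj₁; proj₂)
open import Data.Sum using (_⊎_; inj₁; inj₂; swap)
open import Data.Empty using (⊥; ⊥-elim)
open import Function using (_∘_; id; const)
open import Relation.Nullary using (yes; no)
open import Relation.Binary.PropositionalEquality using (_≡_; _≢_; refl; sym; trans; cong; subst; subst₂; module ≡-Reasoning)

open _≅_

-- 𝔏 x = 𝔊 x 0; the brackets directly below x are numbered from n on, and
-- next x n X is the first number left unused.
𝔊 : Label → ℕ → Seq → LGraph
𝔊 x n X = proj₁ (build x n X)

next : Label → ℕ → Seq → ℕ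
next x n X = proj₂ (build x n X)

≅-refl : ∀ {G} → G ≅ G
≅-refl = record
  { to = id ; from = id ; to∈ = id ; from∈ = id
  ; from∘to = λ _ → refl ; to∘from = λ _ → refl
  ; edge→ = λ _ _ → id ; edge← = λ _ _ → id ; label = λ _ → ↭-refl }

≅-sym : ∀ {G H} → G ≅ H → H ≅ G
≅-sym {G} {H} i = record
  { to = from i ; from = to i ; to∈ = from∈ i ; from∈ = to∈ i
  ; from∘to = to∘from i ; to∘from = from∘to i
  ; edge→ = λ u∈ v∈ e → edge← i (from∈ i u∈) (from∈ i v∈)
      (subst₂ (λ a b → (a , b) ∈ E H) (sym (to∘from i u∈)) (sym (to∘from i v∈)) e)
  ; edge← = λ u∈ v∈ e → subst₂ (λ a b → (a , b) ∈ E H) (to∘from i u∈) (to∘from i v∈)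
      (edge→ i (from∈ i u∈) (from∈ i v∈) e)
  ; label = λ {w} w∈ → ↭-sym (subst (λ z → labelOf G (from i w) ↭ labelOf H z) (to∘from i w∈)
      (label i (from∈ i w∈))) }

≅-trans : ∀ {G M H} → G ≅ M → M ≅ H → G ≅ H
≅-trans i j = record
  { to = to j ∘ to i ; from = from i ∘ from j
  ; to∈ = to∈ j ∘ to∈ i ; from∈ = from∈ i ∘ from∈ j
  ; from∘to = λ v∈ → trans (cong (from i) (from∘to j (to∈ i v∈))) (from∘to i v∈)
  ; to∘from = λ w∈ → trans (cong (to j) (to∘from i (from∈ j w∈))) (to∘from j w∈)
  ; edge→ = λ u∈ v∈ e → edge→ j (to∈ i u∈) (to∈ i v∈) (edge→ i u∈ v∈ e)
  ; edge← = λ u∈ v∈ e → edge← i u∈ v∈ (edge← j (to∈ i u∈) (to∈ i v∈) e)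
  ; label = λ v∈ → ↭-trans (label i v∈) (label j (to∈ i v∈)) }

record Hom (G H : LGraph) (f : Label → Label) : Set where
  field
    map-∈    : ∀ {v} → v ∈ V G → f v ∈ V H
    map-edge : ∀ {u v} → (u , v) ∈ E G → (f u , f v) ∈ E H

≅-from-inverse-homs : ∀ {G H} (f g : Label → Label) → Hom G H f → Hom H G g →
  (∀ {v} → v ∈ V G → g (f v) ≡ v) → (∀ {w} → w ∈ V H → f (g w) ≡ w) →
  (∀ {v} → v ∈ V G → labelOf G v ↭ labelOf H (f v)) → G ≅ H
≅-from-inverse-homs {G} f g hom-f hom-g g∘f f∘g labels = record
  { to = f ; from = g ; to∈ = Hom.map-∈ hom-f ; from∈ = Hom.map-∈ hom-g
  ; from∘to = g∘f ; to∘from = f∘g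
  ; edge→ = λ _ _ → Hom.map-edge hom-f
  ; edge← = λ u∈ v∈ e → subst₂ (λ a b → (a , b) ∈ E G) (g∘f u∈) (g∘f v∈) (Hom.map-edge hom-g e)
  ; label = labels }

-- Conditional, because a or b need not be a vertex at all (𝔏 x ε is empty).
Rooted : ∀ {G H} → G ≅ H → Label → Label → Set
Rooted {G} {H} i a b = (a ∈ V G → to i a ≡ b) × (b ∈ V H → from i b ≡ a)

Rooted-sym : ∀ {G H} {i : G ≅ H} {a b} → Rooted i a b → Rooted (≅-sym i) b a
Rooted-sym (a↦b , b↤a) = b↤a , a↦b

Rooted-absent : ∀ {G H} {i : G ≅ H} {a b} → a ∉ V G → b ∉ V H → Rooted i a b
Rooted-absent a∉ b∉ = ⊥-elim ∘ a∉ , ⊥-elim ∘ b∉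

infix 3 _≅ₚ_

_≅ₚ_ : LGraph × Label → LGraph × Label → Set
(G , a) ≅ₚ (H , b) = Σ (G ≅ H) λ i → Rooted i a b

≅ₚ-sym : ∀ {G H a b} → (G , a) ≅ₚ (H , b) → (H , b) ≅ₚ (G , a)
≅ₚ-sym (i , r) = ≅-sym i , Rooted-sym {i = i} r

≅ₚ-trans : ∀ {G M H a b c} → (G , a) ≅ₚ (M , b) → (M , b) ≅ₚ (H , c) → (G , a) ≅ₚ (H , c)
≅ₚ-trans {G} {M} {H} {a} {b} {c} (i , a↦b , b↤a) (j , b↦c , c↤b) = ≅-trans i j , a↦c , c↤a
  where
  a↦c : a ∈ V G → to j (to i a) ≡ c
  a↦c a∈ = trans (cong (to j) (a↦b a∈)) (b↦c (subst (_∈ V M) (a↦b a∈) (to∈ i a∈)))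
  c↤a : c ∈ V H → from i (from j c) ≡ a
  c↤a c∈ = trans (cong (from i) (c↤b c∈)) (b↤a (subst (_∈ V M) (c↤b c∈) (from∈ j c∈)))

↭⇒≅ₚ : ∀ {G H} → V G ↭ V H → E G ↭ E H → L G ↭ L H → ∀ a → (G , a) ≅ₚ (H , a)
↭⇒≅ₚ {G} {H} V↭ E↭ L↭ a =
  ≅-from-inverse-homs id id
    (record { map-∈ = ∈-resp-↭ V↭ ; map-edge = ∈-resp-↭ E↭ })
    (record { map-∈ = ∈-resp-↭ (↭-sym V↭) ; map-edge = ∈-resp-↭ (↭-sym E↭) })
    (λ _ → refl) (λ _ → refl)
    (λ {v} _ → map⁺ proj₂ (filter-↭ (λ p → proj₁ p ≟L v) L↭))
  , (λ _ → refl) , (λ _ → refl)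

∪-assoc : ∀ G H K a → ((G ∪G H) ∪G K , a) ≅ₚ (G ∪G (H ∪G K) , a)
∪-assoc G H K =
  ↭⇒≅ₚ (++-assoc-↭ (V G) (V H) (V K)) (++-assoc-↭ (E G) (E H) (E K)) (++-assoc-↭ (L G) (L H) (L K))

∪-comm : ∀ G H a → (G ∪G H , a) ≅ₚ (H ∪G G , a)
∪-comm G H = ↭⇒≅ₚ (++-comm (V G) (V H)) (++-comm (E G) (E H)) (++-comm (L G) (L H))

∪-commˡ : ∀ G H K a → ((G ∪G H) ∪G K , a) ≅ₚ ((H ∪G G) ∪G K , a)
∪-commˡ G H K =
  ↭⇒≅ₚ (++⁺ʳ (V K) (++-comm (V G) (V H))) (++⁺ʳ (E K) (++-comm (E G) (E H))) (++⁺ʳ (L K) (++-comm (L G) (L H)))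

record WellFormed (G : LGraph) : Set where
  field
    edge-ends    : ∀ {u v} → (u , v) ∈ E G → u ∈ V G × v ∈ V G
    label-vertex : ∀ {v A} → (v , A) ∈ L G → v ∈ V G
open WellFormed

∪-wellFormed : ∀ {G H} → WellFormed G → WellFormed H → WellFormed (G ∪G H)
∪-wellFormed {G} {H} wfG wfH = record { edge-ends = ends ; label-vertex = vertex }
  where
  ends : ∀ {u v} → (u , v) ∈ E G ++ E H → u ∈ V G ++ V H × v ∈ V G ++ V H
  ends e with ∈-++⁻ (E G) e
  ... | inj₁ e′ = ∈-++⁺ˡ (proj₁ (edge-ends wfG e′)) , ∈-++⁺ˡ (proj₂ (edge-ends wfG e′))
  ... | inj₂ e′ = ∈-++⁺ʳ (V G) (proj₁ (edge-ends wfH e′)) , ∈-++⁺ʳ (V G) (proj₂ (edge-ends wfH e′))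
  vertex : ∀ {v A} → (v , A) ∈ L G ++ L H → v ∈ V G ++ V H
  vertex p with ∈-++⁻ (L G) p
  ... | inj₁ p′ = ∈-++⁺ˡ (label-vertex wfG p′)
  ... | inj₂ p′ = ∈-++⁺ʳ (V G) (label-vertex wfH p′)

labelOf-∪ : ∀ G H v → labelOf (G ∪G H) v ≡ labelOf G v ++ labelOf H v
labelOf-∪ G H v =
  trans (cong (map proj₂) (filter-++ at-v (L G) (L H))) (map-++ proj₂ (filter at-v (L G)) (filter at-v (L H)))
  where at-v = λ (p : Label × Formula) → proj₁ p ≟L v

labelOf-absent : ∀ {G v} → WellFormed G → v ∉ V G → labelOf G v ≡ []
labelOf-absent {G} {v} wfG v∉ =
  cong (map proj₂) (filter-none (λ p → proj₁ p ≟L v)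
    (tabulate λ p e → v∉ (subst (_∈ V G) e (label-vertex wfG p))))

labelOf-unlabelled : ∀ G v → L G ≡ [] → labelOf G v ≡ []
labelOf-unlabelled (lgraph _ _ _) v refl = refl

extension-label : ∀ {G H} → WellFormed G → WellFormed H → (i : G ≅ H) → ∀ {f : Label → Label} {v} →
  (v ∈ V G → f v ≡ to i v) → (f v ∈ V H → v ∈ V G) → labelOf G v ↭ labelOf H (f v)
extension-label {G} {H} wfG wfH i {f} {v} extends reflects with v ∈? V G
... | yes v∈ = subst (λ w → labelOf G v ↭ labelOf H w) (sym (extends v∈)) (label i v∈)
... | no v∉ = ↭-reflexive (trans (labelOf-absent wfG v∉) (sym (labelOf-absent wfH (v∉ ∘ reflects))))

MeetsOnlyAt : List Label → List Label → Label → Set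
MeetsOnlyAt Vs Ws s = ∀ {v} → v ∈ Vs → v ∈ Ws → v ≡ s

meets-sym : ∀ {Vs Ws s} → MeetsOnlyAt Vs Ws s → MeetsOnlyAt Ws Vs s
meets-sym meet p q = meet q p

image-in-other : ∀ {G₁ G₂ H₁ H₂ s t} (i₁ : G₁ ≅ H₁) (i₂ : G₂ ≅ H₂) → MeetsOnlyAt (V H₁) (V H₂) t →
  Rooted i₁ s t → Rooted i₂ s t → ∀ {v} → v ∈ V G₁ → to i₁ v ∈ V H₂ → v ∈ V G₂
image-in-other {G₁} {G₂} {H₁} {H₂} {s} {t} i₁ i₂ meetH r₁ r₂ {v} v∈ image∈ =
  subst (_∈ V G₂) from₂t≡v (from∈ i₂ t∈H₂)
  where
  open ≡-Reasoning
  image≡t = meetH (to∈ i₁ v∈) image∈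
  t∈H₂ = subst (_∈ V H₂) image≡t image∈
  from₂t≡v : from i₂ t ≡ v
  from₂t≡v = begin
    from i₂ t          ≡⟨ proj₂ r₂ t∈H₂ ⟩
    s                  ≡⟨ proj₂ r₁ (subst (_∈ V H₁) image≡t (to∈ i₁ v∈)) ⟨
    from i₁ t          ≡⟨ cong (from i₁) image≡t ⟨
    from i₁ (to i₁ v)  ≡⟨ from∘to i₁ v∈ ⟩
    v                  ∎

glue : List Label → (Label → Label) → (Label → Label) → Label → Label
glue Vs f g v with v ∈? Vs
... | yes _ = f v
... | no _ = g v

glue-≡ˡ : ∀ {Vs f g v} → v ∈ Vs → glue Vs f g v ≡ f v
glue-≡ˡ {Vs} {v = v} v∈ with v ∈? Vs
... | yes _ = refl
... | no v∉ = ⊥-elim (v∉ v∈)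

glue-≡ʳ : ∀ {Vs f g v} → (v ∈ Vs → f v ≡ g v) → glue Vs f g v ≡ g v
glue-≡ʳ {Vs} {v = v} agree with v ∈? Vs
... | yes v∈ = agree v∈
... | no _ = refl

module Glue {G₁ G₂ H₁ H₂ : LGraph} {s t : Label}
  (wfG₁ : WellFormed G₁) (wfG₂ : WellFormed G₂) (wfH₁ : WellFormed H₁) (wfH₂ : WellFormed H₂)
  (meetG : MeetsOnlyAt (V G₁) (V G₂) s) (meetH : MeetsOnlyAt (V H₁) (V H₂) t)
  (i₁ : G₁ ≅ H₁) (i₂ : G₂ ≅ H₂) (r₁ : Rooted i₁ s t) (r₂ : Rooted i₂ s t) where

  glued : Label → Label
  glued = glue (V G₁) (to i₁) (to i₂)

  glued-≡₁ : ∀ {v} → v ∈ V G₁ → glued v ≡ to i₁ v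
  glued-≡₁ = glue-≡ˡ {g = to i₂}

  glued-≡₂ : ∀ {v} → v ∈ V G₂ → glued v ≡ to i₂ v
  glued-≡₂ {v} v∈₂ = glue-≡ʳ {V G₁} agree
    where
    agree : v ∈ V G₁ → to i₁ v ≡ to i₂ v
    agree v∈₁ with refl ← meetG v∈₁ v∈₂ = trans (proj₁ r₁ v∈₁) (sym (proj₁ r₂ v∈₂))

  glued-hom : Hom (G₁ ∪G G₂) (H₁ ∪G H₂) glued
  glued-hom = record { map-∈ = map-∈ ; map-edge = map-edge }
    where
    map-∈ : ∀ {v} → v ∈ V G₁ ++ V G₂ → glued v ∈ V H₁ ++ V H₂
    map-∈ v∈ with ∈-++⁻ (V G₁) v∈
    ... | inj₁ v∈₁ = subst (_∈ V H₁ ++ V H₂) (sym (glued-≡₁ v∈₁)) (∈-++⁺ˡ (to∈ i₁ v∈₁))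
    ... | inj₂ v∈₂ = subst (_∈ V H₁ ++ V H₂) (sym (glued-≡₂ v∈₂)) (∈-++⁺ʳ (V H₁) (to∈ i₂ v∈₂))
    map-edge : ∀ {u v} → (u , v) ∈ E G₁ ++ E G₂ → (glued u , glued v) ∈ E H₁ ++ E H₂
    map-edge e with ∈-++⁻ (E G₁) e
    ... | inj₁ e₁ with (u∈ , v∈) ← edge-ends wfG₁ e₁ =
      subst₂ (λ a b → (a , b) ∈ E H₁ ++ E H₂) (sym (glued-≡₁ u∈)) (sym (glued-≡₁ v∈))
        (∈-++⁺ˡ (edge→ i₁ u∈ v∈ e₁))
    ... | inj₂ e₂ with (u∈ , v∈) ← edge-ends wfG₂ e₂ =
      subst₂ (λ a b → (a , b) ∈ E H₁ ++ E H₂) (sym (glued-≡₂ u∈)) (sym (glued-≡₂ v∈))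
        (∈-++⁺ʳ (E H₁) (edge→ i₂ u∈ v∈ e₂))

  glued-inverse : (g : Label → Label) → (∀ {w} → w ∈ V H₁ → g w ≡ from i₁ w) →
    (∀ {w} → w ∈ V H₂ → g w ≡ from i₂ w) → ∀ {v} → v ∈ V (G₁ ∪G G₂) → g (glued v) ≡ v
  glued-inverse g g≡₁ g≡₂ v∈ with ∈-++⁻ (V G₁) v∈
  ... | inj₁ v∈₁ = trans (cong g (glued-≡₁ v∈₁)) (trans (g≡₁ (to∈ i₁ v∈₁)) (from∘to i₁ v∈₁))
  ... | inj₂ v∈₂ = trans (cong g (glued-≡₂ v∈₂)) (trans (g≡₂ (to∈ i₂ v∈₂)) (from∘to i₂ v∈₂))

  glued-rooted : ∀ {a b} → Rooted i₁ a b → Rooted i₂ a b → a ∈ V (G₁ ∪G G₂) → glued a ≡ b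
  glued-rooted ra₁ ra₂ a∈ with ∈-++⁻ (V G₁) a∈
  ... | inj₁ a∈₁ = trans (glued-≡₁ a∈₁) (proj₁ ra₁ a∈₁)
  ... | inj₂ a∈₂ = trans (glued-≡₂ a∈₂) (proj₁ ra₂ a∈₂)

  glued-label : ∀ {v} → v ∈ V (G₁ ∪G G₂) → labelOf (G₁ ∪G G₂) v ↭ labelOf (H₁ ∪G H₂) (glued v)
  glued-label {v} v∈ =
    subst₂ _↭_ (sym (labelOf-∪ G₁ G₂ v)) (sym (labelOf-∪ H₁ H₂ (glued v)))
      (++⁺ (extension-label wfG₁ wfH₁ i₁ {glued} glued-≡₁ reflects₁)
           (extension-label wfG₂ wfH₂ i₂ {glued} glued-≡₂ reflects₂))
    where
    reflects₁ : glued v ∈ V H₁ → v ∈ V G₁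
    reflects₁ image∈ with ∈-++⁻ (V G₁) v∈
    ... | inj₁ v∈₁ = v∈₁
    ... | inj₂ v∈₂ =
      image-in-other i₂ i₁ (meets-sym meetH) r₂ r₁ v∈₂ (subst (_∈ V H₁) (glued-≡₂ v∈₂) image∈)
    reflects₂ : glued v ∈ V H₂ → v ∈ V G₂
    reflects₂ image∈ with ∈-++⁻ (V G₁) v∈
    ... | inj₁ v∈₁ = image-in-other i₁ i₂ meetH r₁ r₂ v∈₁ (subst (_∈ V H₂) (glued-≡₁ v∈₁) image∈)
    ... | inj₂ v∈₂ = v∈₂

∪-cong : ∀ {G₁ G₂ H₁ H₂ s t} → WellFormed G₁ → WellFormed G₂ → WellFormed H₁ → WellFormed H₂ →
  MeetsOnlyAt (V G₁) (V G₂) s → MeetsOnlyAt (V H₁) (V H₂) t →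
  (i₁ : G₁ ≅ H₁) (i₂ : G₂ ≅ H₂) → Rooted i₁ s t → Rooted i₂ s t →
  Σ ((G₁ ∪G G₂) ≅ (H₁ ∪G H₂)) λ i → ∀ {a b} → Rooted i₁ a b → Rooted i₂ a b → Rooted i a b
∪-cong wfG₁ wfG₂ wfH₁ wfH₂ meetG meetH i₁ i₂ r₁ r₂ =
  ≅-from-inverse-homs F.glued B.glued F.glued-hom B.glued-hom
    (F.glued-inverse B.glued B.glued-≡₁ B.glued-≡₂) (B.glued-inverse F.glued F.glued-≡₁ F.glued-≡₂)
    F.glued-label
  , λ ra₁ ra₂ → F.glued-rooted ra₁ ra₂ , B.glued-rooted (Rooted-sym {i = i₁} ra₁) (Rooted-sym {i = i₂} ra₂)
  where
  module F = Glue wfG₁ wfG₂ wfH₁ wfH₂ meetG meetH i₁ i₂ r₁ r₂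
  module B = Glue wfH₁ wfH₂ wfG₁ wfG₂ meetH meetG (≅-sym i₁) (≅-sym i₂)
               (Rooted-sym {i = i₁} r₁) (Rooted-sym {i = i₂} r₂)

-- Labels grow at the front: v lies below the k-th bracket under x, n ≤ k < m.
Below : Label → ℕ → ℕ → Label → Set
Below x n m v = ∃₂ λ zs k → v ≡ (zs ∷ʳ k) ++ x × n ≤ k × k < m

∷ʳ≢[] : ∀ zs (k : ℕ) → zs ∷ʳ k ≢ []
∷ʳ≢[] [] k ()
∷ʳ≢[] (_ ∷ _) k ()

Below⇒≢ : ∀ {x n m v} → Below x n m v → v ≢ x
Below⇒≢ {x} (zs , k , refl , _) v≡x = ∷ʳ≢[] zs k (++-identityˡ-unique (zs ∷ʳ k) (sym v≡x))

Below-disjoint : ∀ {x a b c d v} → Below x a b v → Below x c d v → b ≤ c → ⊥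
Below-disjoint {x} (zs , k , refl , _ , k<b) (zs′ , k′ , v≡ , c≤k′ , _) b≤c =
  <-irrefl (∷ʳ-injectiveʳ zs zs′ (++-cancelʳ x (zs ∷ʳ k) (zs′ ∷ʳ k′) v≡)) (<-≤-trans k<b (≤-trans b≤c c≤k′))

child-Below : ∀ {x n} → Below x n (suc n) (n ∷ x)
child-Below {x} {n} = [] , n , refl , ≤-refl , ≤-refl

Below-child : ∀ {x n m v} → Below (n ∷ x) 0 m v → Below x n (suc n) v
Below-child {x} {n} (zs , k , refl , _) = zs ∷ʳ k , n , sym (∷ʳ-++ (zs ∷ʳ k) n x) , ≤-refl , ≤-refl

x≢n∷x : ∀ {x : Label} {n} → x ≢ n ∷ x
x≢n∷x e = Below⇒≢ child-Below (sym e)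

Region : Label → ℕ → ℕ → Label → Set
Region x n m v = v ≡ x ⊎ Below x n m v

Region-widen : ∀ {x a b a′ b′ v} → a′ ≤ a → b ≤ b′ → Region x a b v → Region x a′ b′ v
Region-widen _ _ (inj₁ v≡x) = inj₁ v≡x
Region-widen a′≤a b≤b′ (inj₂ (zs , k , v≡ , a≤k , k<b)) = inj₂ (zs , k , v≡ , ≤-trans a′≤a a≤k , <-≤-trans k<b b≤b′)

InRegion : List Label → Label → ℕ → ℕ → Set
InRegion Vs x n m = ∀ {v} → v ∈ Vs → Region x n m v

++-InRegion : ∀ {Vs Ws x n m} → InRegion Vs x n m → InRegion Ws x n m → InRegion (Vs ++ Ws) x n m
++-InRegion {Vs} inVs inWs v∈ with ∈-++⁻ Vs v∈
... | inj₁ v∈Vs = inVs v∈Vs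
... | inj₂ v∈Ws = inWs v∈Ws

regions-meet : ∀ {Vs Ws x a b c d} → InRegion Vs x a b → InRegion Ws x c d → b ≤ c → MeetsOnlyAt Vs Ws x
regions-meet inVs inWs b≤c v∈Vs v∈Ws with inVs v∈Vs | inWs v∈Ws
... | inj₁ v≡x | _ = v≡x
... | inj₂ _ | inj₁ v≡x = v≡x
... | inj₂ below | inj₂ below′ = ⊥-elim (Below-disjoint below below′ b≤c)

≤-next : ∀ x n X → n ≤ next x n X
≤-next x n ε = ≤-refl
≤-next x n (fm A) = ≤-refl
≤-next x n (X ,, Y) = ≤-trans (≤-next x n X) (≤-next x (next x n X) Y)
≤-next x n ∘[ X ] = n≤1+n n
≤-next x n •[ X ] = n≤1+n n

build-region : ∀ x n X → InRegion (V (𝔊 x n X)) x n (next x n X)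
child-below : ∀ x n Z {v} → v ∈ V (𝔊 (n ∷ x) 0 Z) → Below x n (suc n) v
bracket-region : ∀ x n Z {v} → v ∈ x ∷ (n ∷ x) ∷ V (𝔊 (n ∷ x) 0 Z) → Region x n (suc n) v

build-region x n ε ()
build-region x n (fm A) (here refl) = inj₁ refl
build-region x n (X ,, Y) v∈ with ∈-++⁻ (V (𝔊 x n X)) v∈
... | inj₁ v∈X = Region-widen ≤-refl (≤-next x (next x n X) Y) (build-region x n X v∈X)
... | inj₂ v∈Y = Region-widen (≤-next x n X) ≤-refl (build-region x (next x n X) Y v∈Y)
build-region x n ∘[ Z ] = bracket-region x n Z
build-region x n •[ Z ] = bracket-region x n Z

child-below x n Z v∈ with build-region (n ∷ x) 0 Z v∈
... | inj₁ refl = child-Below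
... | inj₂ below = Below-child below

bracket-region x n Z (here refl) = inj₁ refl
bracket-region x n Z (there (here refl)) = inj₂ child-Below
bracket-region x n Z (there (there v∈)) = inj₂ (child-below x n Z v∈)

child-region : ∀ {x n} Z → InRegion (V (𝔊 (n ∷ x) 0 Z)) x n (suc n)
child-region Z = inj₂ ∘ child-below _ _ Z

parent∉child : ∀ {x n} Z → x ∉ V (𝔊 (n ∷ x) 0 Z)
parent∉child Z x∈ = Below⇒≢ (child-below _ _ Z x∈) refl

fresh∉ : ∀ x a X {n} → next x a X ≤ n → n ∷ x ∉ V (𝔊 x a X)
fresh∉ x a X next≤n n∷x∈ with build-region x a X n∷x∈
... | inj₁ n∷x≡x = x≢n∷x (sym n∷x≡x)
... | inj₂ below = Below-disjoint below child-Below next≤n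

OnlyAmong : List Label → Label → Label → Set
OnlyAmong Vs a b = ∀ {v} → v ∈ Vs → v ≡ a ⊎ v ≡ b

record Link (a b : Label) (G : LGraph) : Set where
  field
    distinct   : a ≢ b
    source∈    : a ∈ V G
    target∈    : b ∈ V G
    vertices   : OnlyAmong (V G) a b
    edge       : (a , b) ∈ E G
    edges      : ∀ {u v} → (u , v) ∈ E G → u ≡ a × v ≡ b
    unlabelled : L G ≡ []

Link-wellFormed : ∀ {a b G} → Link a b G → WellFormed G
Link-wellFormed {G = G} ℓ = record { edge-ends = ends ; label-vertex = vertex }
  where
  open Link ℓ
  ends : ∀ {u v} → (u , v) ∈ E G → u ∈ V G × v ∈ V G
  ends e with refl , refl ← edges e = source∈ , target∈
  vertex : ∀ {v A} → (v , A) ∈ L G → v ∈ V G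
  vertex p with () ← subst (_ ∈_) unlabelled p

-- 𝔊 x n ∘[ Z ] computes to ∘-frame x n ∪G 𝔊 (n ∷ x) 0 Z, and likewise for •.
∘-frame •-frame : Label → ℕ → LGraph
∘-frame x n = lgraph (x ∷ (n ∷ x) ∷ []) ((x , n ∷ x) ∷ []) []
•-frame x n = lgraph (x ∷ (n ∷ x) ∷ []) ((n ∷ x , x) ∷ []) []

∘-link : ∀ x n → Link x (n ∷ x) (∘-frame x n)
∘-link x n = record
  { distinct = x≢n∷x ; source∈ = here refl ; target∈ = there (here refl)
  ; vertices = λ { (here refl) → inj₁ refl ; (there (here refl)) → inj₂ refl }
  ; edge = here refl ; edges = λ { (here refl) → refl , refl } ; unlabelled = refl }

•-link : ∀ x n → Link (n ∷ x) x (•-frame x n)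
•-link x n = record
  { distinct = x≢n∷x ∘ sym ; source∈ = there (here refl) ; target∈ = here refl
  ; vertices = λ { (here refl) → inj₂ refl ; (there (here refl)) → inj₁ refl }
  ; edge = here refl ; edges = λ { (here refl) → refl , refl } ; unlabelled = refl }

switch : Label → Label → Label → Label → Label
switch a a′ b′ v with v ≟L a
... | yes _ = a′
... | no _ = b′

switch-≡ : ∀ a a′ b′ → switch a a′ b′ a ≡ a′
switch-≡ a a′ b′ with a ≟L a
... | yes _ = refl
... | no a≢a = ⊥-elim (a≢a refl)

switch-≢ : ∀ a a′ b′ {v} → v ≢ a → switch a a′ b′ v ≡ b′
switch-≢ a a′ b′ {v} v≢a with v ≟L a
... | yes v≡a = ⊥-elim (v≢a v≡a)
... | no _ = refl

module _ {a b a′ b′ G H} (ℓ : Link a b G) (ℓ′ : Link a′ b′ H) where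
  private
    module ℓ = Link ℓ
    module ℓ′ = Link ℓ′

  switch-tgt : switch a a′ b′ b ≡ b′
  switch-tgt = switch-≢ a a′ b′ (ℓ.distinct ∘ sym)

  switch-hom : Hom G H (switch a a′ b′)
  switch-hom = record { map-∈ = map-∈ ; map-edge = map-edge }
    where
    map-∈ : ∀ {v} → v ∈ V G → switch a a′ b′ v ∈ V H
    map-∈ v∈ with ℓ.vertices v∈
    ... | inj₁ refl = subst (_∈ V H) (sym (switch-≡ a a′ b′)) ℓ′.source∈
    ... | inj₂ refl = subst (_∈ V H) (sym switch-tgt) ℓ′.target∈
    map-edge : ∀ {u v} → (u , v) ∈ E G → (switch a a′ b′ u , switch a a′ b′ v) ∈ E H
    map-edge e with refl , refl ← ℓ.edges e =
      subst₂ (λ u v → (u , v) ∈ E H) (sym (switch-≡ a a′ b′)) (sym switch-tgt) ℓ′.edge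

  switch-inverse : ∀ {v} → v ∈ V G → switch a′ a b (switch a a′ b′ v) ≡ v
  switch-inverse v∈ with ℓ.vertices v∈
  ... | inj₁ refl = trans (cong (switch a′ a b) (switch-≡ a a′ b′)) (switch-≡ a′ a b)
  ... | inj₂ refl = trans (cong (switch a′ a b) switch-tgt) (switch-≢ a′ a b (ℓ′.distinct ∘ sym))

Link-≅ : ∀ {a b a′ b′ G H} → Link a b G → Link a′ b′ H → Σ (G ≅ H) λ i → Rooted i a a′ × Rooted i b b′
Link-≅ {a} {b} {a′} {b′} {G} {H} ℓ ℓ′ =
  ≅-from-inverse-homs _ _ (switch-hom ℓ ℓ′) (switch-hom ℓ′ ℓ) (switch-inverse ℓ ℓ′) (switch-inverse ℓ′ ℓ)
    (λ {v} _ → ↭-reflexive (trans (labelOf-unlabelled G v (Link.unlabelled ℓ))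
                                  (sym (labelOf-unlabelled H _ (Link.unlabelled ℓ′)))))
  , (const (switch-≡ a a′ b′) , const (switch-≡ a′ a b)) , (const (switch-tgt ℓ ℓ′) , const (switch-tgt ℓ′ ℓ))

build-wellFormed : ∀ x n X → WellFormed (𝔊 x n X)
build-wellFormed x n ε = record { edge-ends = λ () ; label-vertex = λ () }
build-wellFormed x n (fm A) = record { edge-ends = λ () ; label-vertex = λ { (here refl) → here refl } }
build-wellFormed x n (X ,, Y) = ∪-wellFormed (build-wellFormed x n X) (build-wellFormed x (next x n X) Y)
build-wellFormed x n ∘[ Z ] = ∪-wellFormed (Link-wellFormed (∘-link x n)) (build-wellFormed (n ∷ x) 0 Z)
build-wellFormed x n •[ Z ] = ∪-wellFormed (Link-wellFormed (•-link x n)) (build-wellFormed (n ∷ x) 0 Z)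

atom : Label → Formula → LGraph
atom x A = lgraph (x ∷ []) [] ((x , A) ∷ [])

labelOf-atom : ∀ x A → labelOf (atom x A) x ≡ A ∷ []
labelOf-atom x A with x ≟L x
... | yes _ = refl
... | no x≢x = ⊥-elim (x≢x refl)

atom-≅ₚ : ∀ x x′ A → (atom x A , x) ≅ₚ (atom x′ A , x′)
atom-≅ₚ x x′ A =
  ≅-from-inverse-homs (const x′) (const x) (atom-hom x x′) (atom-hom x′ x)
    (λ { (here refl) → refl }) (λ { (here refl) → refl })
    (λ { (here refl) → ↭-reflexive (trans (labelOf-atom x A) (sym (labelOf-atom x′ A))) })
  , (λ _ → refl) , (λ _ → refl)
  where
  atom-hom : ∀ y y′ → Hom (atom y A) (atom y′ A) (const y′)
  atom-hom y y′ = record { map-∈ = const (here refl) ; map-edge = λ () }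

Apart : Label → ℕ → Seq → ℕ → Seq → Set
Apart x a X b Y = next x a X ≤ b ⊎ next x b Y ≤ a

apart-meet : ∀ {x a b} X Y → Apart x a X b Y → MeetsOnlyAt (V (𝔊 x a X)) (V (𝔊 x b Y)) x
apart-meet {x} {a} {b} X Y (inj₁ le) = regions-meet (build-region x a X) (build-region x b Y) le
apart-meet {x} {a} {b} X Y (inj₂ le) = meets-sym (regions-meet (build-region x b Y) (build-region x a X) le)

siblings-cong : ∀ {x a b x′ c d} X Y X′ Y′ → Apart x a X b Y → Apart x′ c X′ d Y′ →
  (𝔊 x a X , x) ≅ₚ (𝔊 x′ c X′ , x′) → (𝔊 x b Y , x) ≅ₚ (𝔊 x′ d Y′ , x′) →
  (𝔊 x a X ∪G 𝔊 x b Y , x) ≅ₚ (𝔊 x′ c X′ ∪G 𝔊 x′ d Y′ , x′)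
siblings-cong {x} {a} {b} {x′} {c} {d} X Y X′ Y′ apart apart′ (i₁ , r₁) (i₂ , r₂) =
  proj₁ glued , proj₂ glued r₁ r₂
  where
  glued = ∪-cong (build-wellFormed x a X) (build-wellFormed x b Y)
            (build-wellFormed x′ c X′) (build-wellFormed x′ d Y′)
            (apart-meet X Y apart) (apart-meet X′ Y′ apart′) i₁ i₂ r₁ r₂

meets-frame-child : ∀ {Vs x n} Z → OnlyAmong Vs x (n ∷ x) → MeetsOnlyAt Vs (V (𝔊 (n ∷ x) 0 Z)) (n ∷ x)
meets-frame-child Z only v∈P v∈Z with only v∈P
... | inj₁ refl = ⊥-elim (parent∉child Z v∈Z)
... | inj₂ v≡n∷x = v≡n∷x

frame-region : ∀ {Vs x n} → OnlyAmong Vs x (n ∷ x) → InRegion Vs x n (suc n)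
frame-region only v∈ with only v∈
... | inj₁ v≡x = inj₁ v≡x
... | inj₂ refl = inj₂ child-Below

child-cong : ∀ {P P′ x n x′ m} Z Z′ → WellFormed P → WellFormed P′ →
  OnlyAmong (V P) x (n ∷ x) → OnlyAmong (V P′) x′ (m ∷ x′) →
  (i : P ≅ P′) → Rooted i x x′ → Rooted i (n ∷ x) (m ∷ x′) →
  (𝔊 (n ∷ x) 0 Z , n ∷ x) ≅ₚ (𝔊 (m ∷ x′) 0 Z′ , m ∷ x′) →
  (P ∪G 𝔊 (n ∷ x) 0 Z , x) ≅ₚ (P′ ∪G 𝔊 (m ∷ x′) 0 Z′ , x′)
child-cong {x = x} {n} {x′} {m} Z Z′ wfP wfP′ only only′ i rx rc (j , rj) =
  proj₁ glued , proj₂ glued rx (Rooted-absent {i = j} (parent∉child Z) (parent∉child Z′))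
  where
  glued = ∪-cong wfP (build-wellFormed (n ∷ x) 0 Z) wfP′ (build-wellFormed (m ∷ x′) 0 Z′)
            (meets-frame-child Z only) (meets-frame-child Z′ only′) i j rc rj

∘-cong : ∀ {x n x′ m} Z Z′ → (𝔊 (n ∷ x) 0 Z , n ∷ x) ≅ₚ (𝔊 (m ∷ x′) 0 Z′ , m ∷ x′) →
  (𝔊 x n ∘[ Z ] , x) ≅ₚ (𝔊 x′ m ∘[ Z′ ] , x′)
∘-cong {x} {n} {x′} {m} Z Z′ with i , rx , rc ← Link-≅ (∘-link x n) (∘-link x′ m) =
  child-cong Z Z′ (Link-wellFormed (∘-link x n)) (Link-wellFormed (∘-link x′ m))
    (Link.vertices (∘-link x n)) (Link.vertices (∘-link x′ m)) i rx rc

•-cong : ∀ {x n x′ m} Z Z′ → (𝔊 (n ∷ x) 0 Z , n ∷ x) ≅ₚ (𝔊 (m ∷ x′) 0 Z′ , m ∷ x′) →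
  (𝔊 x n •[ Z ] , x) ≅ₚ (𝔊 x′ m •[ Z′ ] , x′)
•-cong {x} {n} {x′} {m} Z Z′ with i , rc , rx ← Link-≅ (•-link x n) (•-link x′ m) =
  child-cong Z Z′ (Link-wellFormed (•-link x n)) (Link-wellFormed (•-link x′ m))
    (swap ∘ Link.vertices (•-link x n)) (swap ∘ Link.vertices (•-link x′ m)) i rx rc

𝔊-relabel : ∀ X x n x′ m → (𝔊 x n X , x) ≅ₚ (𝔊 x′ m X , x′)
𝔊-relabel ε x n x′ m = ≅-refl , (λ ()) , (λ ())
𝔊-relabel (fm A) x n x′ m = atom-≅ₚ x x′ A
𝔊-relabel (X ,, Y) x n x′ m =
  siblings-cong X Y X Y (inj₁ ≤-refl) (inj₁ ≤-refl)
    (𝔊-relabel X x n x′ m) (𝔊-relabel Y x (next x n X) x′ (next x′ m X))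
𝔊-relabel ∘[ Z ] x n x′ m = ∘-cong Z Z (𝔊-relabel Z (n ∷ x) 0 (m ∷ x′) 0)
𝔊-relabel •[ Z ] x n x′ m = •-cong Z Z (𝔊-relabel Z (n ∷ x) 0 (m ∷ x′) 0)

𝔊-resp-≈ₛ : ∀ {X Y} → X ≈ₛ Y → ∀ x n x′ m → (𝔊 x n X , x) ≅ₚ (𝔊 x′ m Y , x′)
𝔊-resp-≈ₛ {X} ≈-refl x n x′ m = 𝔊-relabel X x n x′ m
𝔊-resp-≈ₛ (≈-sym p) x n x′ m = ≅ₚ-sym (𝔊-resp-≈ₛ p x′ m x n)
𝔊-resp-≈ₛ (≈-trans p q) x n x′ m = ≅ₚ-trans (𝔊-resp-≈ₛ p x n x′ m) (𝔊-resp-≈ₛ q x′ m x′ m)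
𝔊-resp-≈ₛ (≈-assoc {X} {Y} {Z}) x n x′ m =
  ≅ₚ-trans (∪-assoc (𝔊 x n X) (𝔊 x (next x n X) Y) (𝔊 x (next x (next x n X) Y) Z) x)
    (𝔊-relabel (X ,, (Y ,, Z)) x n x′ m)
𝔊-resp-≈ₛ (≈-comm {X} {Y}) x n x′ m =
  ≅ₚ-trans (siblings-cong X Y X Y (inj₁ ≤-refl) (inj₂ ≤-refl)
              (𝔊-relabel X x n x (next x n Y)) (𝔊-relabel Y x (next x n X) x n))
    (≅ₚ-trans (∪-comm (𝔊 x (next x n Y) X) (𝔊 x n Y) x) (𝔊-relabel (Y ,, X) x n x′ m))
𝔊-resp-≈ₛ (≈-unit {X}) x n x′ m = 𝔊-relabel X x n x′ m
𝔊-resp-≈ₛ (≈-,, {X} {X′} {Y} {Y′} p q) x n x′ m =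
  siblings-cong X Y X′ Y′ (inj₁ ≤-refl) (inj₁ ≤-refl) (𝔊-resp-≈ₛ p x n x′ m) (𝔊-resp-≈ₛ q _ _ _ _)
𝔊-resp-≈ₛ (≈-∘ {Z} {Z′} p) x n x′ m = ∘-cong Z Z′ (𝔊-resp-≈ₛ p (n ∷ x) 0 (m ∷ x′) 0)
𝔊-resp-≈ₛ (≈-• {Z} {Z′} p) x n x′ m = •-cong Z Z′ (𝔊-resp-≈ₛ p (n ∷ x) 0 (m ∷ x′) 0)

display-≅ : ∀ {P P′} X Y x y → WellFormed P → WellFormed P′ →
  OnlyAmong (V P) x (next x 0 X ∷ x) → OnlyAmong (V P′) y (0 ∷ y) →
  (i : P ≅ P′) → Rooted i x (0 ∷ y) → Rooted i (next x 0 X ∷ x) y →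
  (𝔊 x 0 X ∪G (P ∪G 𝔊 (next x 0 X ∷ x) 0 Y)) ≅ ((P′ ∪G 𝔊 (0 ∷ y) 0 X) ∪G 𝔊 y 1 Y)
display-≅ {P} {P′} X Y x y wfP wfP′ only only′ i rx rc =
  ≅-trans (proj₁ (≅ₚ-sym (∪-assoc (𝔊 x 0 X) P (𝔊 (n ∷ x) 0 Y) x)))
    (≅-trans (proj₁ outer) (proj₁ (∪-commˡ (𝔊 (0 ∷ y) 0 X) P′ (𝔊 y 1 Y) y)))
  where
  n = next x 0 X
  X≅X = 𝔊-relabel X x 0 (0 ∷ y) 0
  Y≅Y = 𝔊-relabel Y (n ∷ x) 0 y 1
  X-meets-P : MeetsOnlyAt (V (𝔊 x 0 X)) (V P) x
  X-meets-P = regions-meet (build-region x 0 X) (frame-region only) ≤-refl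
  XP-meets-Y : MeetsOnlyAt (V (𝔊 x 0 X ∪G P)) (V (𝔊 (n ∷ x) 0 Y)) (n ∷ x)
  XP-meets-Y v∈ v∈Y with ∈-++⁻ (V (𝔊 x 0 X)) v∈
  ... | inj₁ v∈X = ⊥-elim (Below⇒≢ (child-below x n Y v∈Y)
                     (regions-meet (build-region x 0 X) (child-region Y) ≤-refl v∈X v∈Y))
  ... | inj₂ v∈P = meets-frame-child Y only v∈P v∈Y
  XP′-meets-Y : MeetsOnlyAt (V (𝔊 (0 ∷ y) 0 X ∪G P′)) (V (𝔊 y 1 Y)) y
  XP′-meets-Y = regions-meet (++-InRegion (child-region X) (frame-region only′)) (build-region y 1 Y) ≤-refl
  inner = ∪-cong (build-wellFormed x 0 X) wfP (build-wellFormed (0 ∷ y) 0 X) wfP′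
            X-meets-P (meets-sym (meets-frame-child X only′)) (proj₁ X≅X) i (proj₂ X≅X) rx
  outer = ∪-cong (∪-wellFormed (build-wellFormed x 0 X) wfP) (build-wellFormed (n ∷ x) 0 Y)
            (∪-wellFormed (build-wellFormed (0 ∷ y) 0 X) wfP′) (build-wellFormed y 1 Y)
            XP-meets-Y XP′-meets-Y (proj₁ inner) (proj₁ Y≅Y)
            (proj₂ inner (Rooted-absent {i = proj₁ X≅X} (fresh∉ x 0 X ≤-refl) (parent∉child X)) rc)
            (proj₂ Y≅Y)

rf-≅ : ∀ X Y x y → 𝔏 x (X ,, ∘[ Y ]) ≅ 𝔏 y (•[ X ] ,, Y)
rf-≅ X Y x y with i , rx , rc ← Link-≅ (∘-link x (next x 0 X)) (•-link y 0) =
  display-≅ X Y x y (Link-wellFormed (∘-link x _)) (Link-wellFormed (•-link y 0))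
    (Link.vertices (∘-link x _)) (swap ∘ Link.vertices (•-link y 0)) i rx rc

rp-≅ : ∀ X Y x y → 𝔏 x (X ,, •[ Y ]) ≅ 𝔏 y (∘[ X ] ,, Y)
rp-≅ X Y x y with i , rc , rx ← Link-≅ (•-link x (next x 0 X)) (∘-link y 0) =
  display-≅ X Y x y (Link-wellFormed (•-link x _)) (Link-wellFormed (∘-link y 0))
    (swap ∘ Link.vertices (•-link x _)) (Link.vertices (∘-link y 0)) i rx rc

𝔏-resp-≈ₛ : ∀ {X Y} → X ≈ₛ Y → ∀ x y → 𝔏 x X ≅ 𝔏 y Y
𝔏-resp-≈ₛ p x y = proj₁ (𝔊-resp-≈ₛ p x 0 y 0)

display-step-≅ : ∀ {S T} → DisplayStep S T → ∀ x y → 𝔏 x S ≅ 𝔏 y T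
display-step-≅ (rf X Y S≈ T≈) x y =
  ≅-trans (𝔏-resp-≈ₛ S≈ x x) (≅-trans (rf-≅ X Y x y) (𝔏-resp-≈ₛ (≈-sym T≈) y y))
display-step-≅ (rp X Y S≈ T≈) x y =
  ≅-trans (𝔏-resp-≈ₛ S≈ x x) (≅-trans (rp-≅ X Y x y) (𝔏-resp-≈ₛ (≈-sym T≈) y y))

display-derives-≅ : ∀ {X Y} → DisplayDerives X Y → ∀ x y → 𝔏 x X ≅ 𝔏 y Y
display-derives-≅ (done X≈Y) x y = 𝔏-resp-≈ₛ X≈Y x y
display-derives-≅ (step s d) x y = ≅-trans (display-step-≅ s x y) (display-derives-≅ d y y)

corollary3p10 : (x y : Label) (X Y : Seq) → DisplayEquiv X Y → 𝔏 x X ≅ 𝔏 y Y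
corollary3p10 x y X Y (X⇒Y , _) = display-derives-≅ X⇒Y x y
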